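{- Let $x,y\in\{0,1\}^n$ and let $i\neq j$ be indices in $\{1,\dots,n-1\}$ such that $x_ix_{i+1}=01$ and $y_iy_{i+1}\neq 01$, and $x_jx_{j+1}\neq 01$ and $y_jy_{j+1}=01$. Then $M(\sigma^k(x))\neq M(\sigma^k(y))$ for every integer $k\geq 0$.
   Context: For a bitstring $z=z_1\cdots z_n$, read each 0 as an opening and each 1 as a closing parenthesis and match closest pairs in the usual way; $M(z)$ is the set of index pairs $(p,q)$ of matched parentheses. $\sigma(z_1\cdots z_n)=z_nz_1\cdots z_{n-1}$ is cyclic right rotation. -}

module Defs where

open import Data.Nat using (ℕ; zero; suc)
open import Data.List using (List; []; _∷_)
open import Data.Vec using (Vec; []; _∷_; last; init; toList)
open import Data.Product using (_×_; _,_)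
open import Data.List.Membership.Propositional using (_∈_)

-- A bit: b0 = "0" (opening parenthesis), b1 = "1" (closing parenthesis).
data Bit : Set where
  b0 b1 : Bit

-- 1-indexed access z_i to a bitstring; (out-of-range indices are never used:
-- the statement assumes 1 ≤ i and i + 1 ≤ n).
at : ∀ {n} → Vec Bit n → ℕ → Bit
at [] _ = b0
at (z ∷ zs) zero = b0
at (z ∷ zs) (suc zero) = z
at (z ∷ zs) (suc (suc k)) = at zs (suc k)

σ : ∀ {n} → Vec Bit n → Vec Bit n
σ {zero} [] = []
σ {suc n} zs = last zs ∷ init zs

σ^ : ∀ {n} → ℕ → Vec Bit n → Vec Bit n
σ^ zero z = z
σ^ (suc k) z = σ (σ^ k z)

-- Parenthesis matching (closest pairs), scanning left to right with a stack of
-- the indices of currently unmatched opening parentheses.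
matchGo : ℕ → List ℕ → List Bit → List (ℕ × ℕ)
matchGo i st [] = []
matchGo i st (b0 ∷ zs) = matchGo (suc i) (i ∷ st) zs
matchGo i [] (b1 ∷ zs) = matchGo (suc i) [] zs
matchGo i (p ∷ st) (b1 ∷ zs) = (p , i) ∷ matchGo (suc i) st zs

-- M(z): the set of index pairs (p , q) (1-indexed) of matched parentheses,
-- given as a list; (p , q) ∈ M z is membership.
M : ∀ {n} → Vec Bit n → List (ℕ × ℕ)
M z = matchGo 1 [] (toList z)

SameM : ∀ {n} → Vec Bit n → Vec Bit n → Set
SameM a b = ∀ p q → ((p , q) ∈ M a → (p , q) ∈ M b) × ((p , q) ∈ M b → (p , q) ∈ M a)

Is01At : ∀ {n} → Vec Bit n → ℕ → Set
Is01At z i = (at z i ≡ b0) × (at z (suc i) ≡ b1)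
  where open import Relation.Binary.PropositionalEquality using (_≡_)

-- An adjacent pair (p , p + 1) is matched in z exactly when z_p z_{p+1} = 01.
-- Read cyclically (z_n z_1 counts as the pair at position n), a 01 at position i
-- of z becomes a 01 at position i + 1 (mod n) of σ z.  So at every k there are
-- distinct positions i' and j' where σ^k x has a cyclic 01 that σ^k y lacks and
-- vice versa; at most one of them is the wrap-around position n, and the other
-- is an ordinary adjacent pair matched in one of M(σ^k x), M(σ^k y) only.
module Submission where

open import Defs
open import Data.Nat using (ℕ; zero; suc; _+_; _≤_; _<_; z≤n; s≤s; _≟_)
open import Data.Nat.Properties
  using (+-identityʳ; +-suc; suc-injective; <-irrefl; <⇒≤; m≤n⇒m<n∨m≡n)
open import Data.Vec using (Vec; []; _∷_; last; init; toList)
open import Data.List using (List; []; _∷_)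
open import Data.List.Relation.Unary.Any using (here; there)
open import Data.List.Membership.Propositional using (_∈_)
open import Data.Product using (_×_; _,_; proj₁; ∃-syntax; swap)
open import Data.Sum using (_⊎_; inj₁; inj₂)
open import Data.Empty using (⊥-elim)
open import Function.Bundles using (_⇔_; mk⇔; Equivalence)
open import Relation.Nullary using (¬_; yes; no)
open import Relation.Binary.PropositionalEquality
  using (_≡_; _≢_; refl; sym; trans; subst)

listAt : List Bit → ℕ → Bit
listAt []       _       = b0
listAt (b ∷ bs) zero    = b
listAt (b ∷ bs) (suc m) = listAt bs m

at-toList : ∀ {n} (z : Vec Bit n) m → at z (suc m) ≡ listAt (toList z) m
at-toList []       m       = refl
at-toList (b ∷ bs) zero    = refl
at-toList (b ∷ bs) (suc m) = at-toList bs m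

HasBitAt : List Bit → ℕ → ℕ → Bit → Set
HasBitAt l s p b = ∃[ m ] p ≡ s + m × listAt l m ≡ b

HasBitAt-∷ : ∀ {c l s p b} → HasBitAt l (suc s) p b → HasBitAt (c ∷ l) s p b
HasBitAt-∷ {s = s} (m , refl , lm≡b) = suc m , sym (+-suc s m) , lm≡b

matchGo-opener : ∀ s st l {p q} → (p , q) ∈ matchGo s st l → p ∈ st ⊎ HasBitAt l s p b0
matchGo-opener s st (b0 ∷ l) mem with matchGo-opener (suc s) (s ∷ st) l mem
... | inj₁ (here refl)  = inj₂ (0 , sym (+-identityʳ s) , refl)
... | inj₁ (there p∈st) = inj₁ p∈st
... | inj₂ h            = inj₂ (HasBitAt-∷ h)
matchGo-opener s [] (b1 ∷ l) mem with matchGo-opener (suc s) [] l mem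
... | inj₂ h = inj₂ (HasBitAt-∷ h)
matchGo-opener s (t ∷ st) (b1 ∷ l) (here refl) = inj₁ (here refl)
matchGo-opener s (t ∷ st) (b1 ∷ l) (there mem) with matchGo-opener (suc s) st l mem
... | inj₁ p∈st = inj₁ (there p∈st)
... | inj₂ h    = inj₂ (HasBitAt-∷ h)

matchGo-closer : ∀ s st l {p q} → (p , q) ∈ matchGo s st l → HasBitAt l s q b1
matchGo-closer s st       (b0 ∷ l) mem         = HasBitAt-∷ (matchGo-closer (suc s) (s ∷ st) l mem)
matchGo-closer s []       (b1 ∷ l) mem         = HasBitAt-∷ (matchGo-closer (suc s) [] l mem)
matchGo-closer s (t ∷ st) (b1 ∷ l) (here refl) = 0 , sym (+-identityʳ s) , refl
matchGo-closer s (t ∷ st) (b1 ∷ l) (there mem) = HasBitAt-∷ (matchGo-closer (suc s) st l mem)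

01⇒∈matchGo : ∀ s st l m → listAt l m ≡ b0 → listAt l (suc m) ≡ b1 →
              (s + m , suc (s + m)) ∈ matchGo s st l
01⇒∈matchGo s st       (b0 ∷ b1 ∷ l) zero    _  _  rewrite +-identityʳ s = here refl
01⇒∈matchGo s st       (b0 ∷ l)      (suc m) l0 l1 rewrite +-suc s m =
  01⇒∈matchGo (suc s) (s ∷ st) l m l0 l1
01⇒∈matchGo s []       (b1 ∷ l)      (suc m) l0 l1 rewrite +-suc s m =
  01⇒∈matchGo (suc s) [] l m l0 l1
01⇒∈matchGo s (t ∷ st) (b1 ∷ l)      (suc m) l0 l1 rewrite +-suc s m =
  there (01⇒∈matchGo (suc s) st l m l0 l1)

HasBitAt⇒at : ∀ {n} (z : Vec Bit n) {p b} → HasBitAt (toList z) 1 p b → at z p ≡ b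
HasBitAt⇒at z (m , refl , zm≡b) = trans (at-toList z m) zm≡b

∈M⇒Is01At : ∀ {n} (z : Vec Bit n) {p} → (p , suc p) ∈ M z → Is01At z p
∈M⇒Is01At z mem with matchGo-opener 1 [] (toList z) mem
... | inj₂ opener = HasBitAt⇒at z opener , HasBitAt⇒at z (matchGo-closer 1 [] (toList z) mem)

Is01At⇒∈M : ∀ {n} (z : Vec Bit n) m → Is01At z (suc m) → (suc m , suc (suc m)) ∈ M z
Is01At⇒∈M z m (z0 , z1) =
  01⇒∈matchGo 1 [] (toList z) m (trans (sym (at-toList z m)) z0)
                                 (trans (sym (at-toList z (suc m))) z1)

Is01At-separates : ∀ {n} (a b : Vec Bit n) m →
                   Is01At a (suc m) → ¬ Is01At b (suc m) → ¬ SameM a b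
Is01At-separates a b m a01 ¬b01 same =
  ¬b01 (∈M⇒Is01At b (proj₁ (same _ _) (Is01At⇒∈M a m a01)))

SameM-sym : ∀ {n} (a b : Vec Bit n) → SameM a b → SameM b a
SameM-sym _ _ same p q = swap (same p q)

IsPosition : ℕ → ℕ → Set
IsPosition n i = 1 ≤ i × i ≤ n

next : ℕ → ℕ → ℕ
next n i with i ≟ n
... | yes _ = 1
... | no  _ = suc i

next-self : ∀ n → next n n ≡ 1
next-self n with n ≟ n
... | yes _   = refl
... | no  n≢n = ⊥-elim (n≢n refl)

next-< : ∀ {n i} → i < n → next n i ≡ suc i
next-< {n} {i} i<n with i ≟ n
... | yes refl = ⊥-elim (<-irrefl refl i<n)
... | no  _    = refl

next-position : ∀ {n i} → IsPosition n i → IsPosition n (next n i)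
next-position {n} (1≤i , i≤n) with m≤n⇒m<n∨m≡n i≤n
... | inj₂ refl rewrite next-self n = s≤s z≤n , 1≤i
... | inj₁ i<n  rewrite next-< i<n  = s≤s z≤n , i<n

next-injective : ∀ {n i j} → IsPosition n i → IsPosition n j → next n i ≡ next n j → i ≡ j
next-injective {n} (s≤s z≤n , i≤n) (s≤s z≤n , j≤n) eq
  with m≤n⇒m<n∨m≡n i≤n | m≤n⇒m<n∨m≡n j≤n
... | inj₂ refl | inj₂ refl = refl
... | inj₂ refl | inj₁ j<n rewrite next-self n | next-< j<n with eq
...   | ()
next-injective {n} (s≤s z≤n , _) (s≤s z≤n , _) eq | inj₁ i<n | inj₂ refl
  rewrite next-self n | next-< i<n with eq
...   | ()
next-injective _ _ eq | inj₁ i<n | inj₁ j<n rewrite next-< i<n | next-< j<n = suc-injective eq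

last-at : ∀ {n} (z : Vec Bit (suc n)) → last z ≡ at z (suc n)
last-at (b ∷ [])     = refl
last-at (b ∷ c ∷ bs) = last-at (c ∷ bs)

init-at : ∀ {n} (z : Vec Bit (suc n)) m → m < n → at (init z) (suc m) ≡ at z (suc m)
init-at (b ∷ c ∷ bs) zero    _         = refl
init-at (b ∷ c ∷ bs) (suc m) (s≤s m<n) = init-at (c ∷ bs) m m<n

at-σ-next : ∀ {n} (z : Vec Bit n) {i} → IsPosition n i → at (σ z) (next n i) ≡ at z i
at-σ-next {suc n} z (s≤s z≤n , i≤n) with m≤n⇒m<n∨m≡n i≤n
... | inj₂ refl rewrite next-self (suc n) = last-at z
at-σ-next {suc n} z {suc m} (s≤s z≤n , _) | inj₁ (s≤s m<n) rewrite next-< (s≤s m<n) =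
  init-at z m m<n

Cyclic01At : ∀ {n} → Vec Bit n → ℕ → Set
Cyclic01At {n} z i = (at z i ≡ b0) × (at z (next n i) ≡ b1)

Cyclic01At⇔Is01At : ∀ {n} (z : Vec Bit n) {i} → i < n → Cyclic01At z i ⇔ Is01At z i
Cyclic01At⇔Is01At z i<n = mk⇔
  (λ (z0 , z1) → z0 , subst (λ t → at z t ≡ b1) (next-< i<n) z1)
  (λ (z0 , z1) → z0 , subst (λ t → at z t ≡ b1) (sym (next-< i<n)) z1)

Cyclic01At-σ : ∀ {n} (z : Vec Bit n) {i} → IsPosition n i →
               Cyclic01At (σ z) (next n i) ⇔ Cyclic01At z i
Cyclic01At-σ z pos = mk⇔
  (λ (z0 , z1) → trans (sym (at-σ-next z pos)) z0 , trans (sym (at-σ-next z pos′)) z1)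
  (λ (z0 , z1) → trans (at-σ-next z pos) z0 , trans (at-σ-next z pos′) z1)
  where pos′ = next-position pos

Separates : ∀ {n} → Vec Bit n → Vec Bit n → ℕ → Set
Separates {n} a b i = IsPosition n i × Cyclic01At a i × ¬ Cyclic01At b i

Is01At⇒Separates : ∀ {n} (a b : Vec Bit n) {i} → 1 ≤ i → i < n →
                   Is01At a i → ¬ Is01At b i → Separates a b i
Is01At⇒Separates a b 1≤i i<n a01 ¬b01 =
  (1≤i , <⇒≤ i<n) ,
  Equivalence.from (Cyclic01At⇔Is01At a i<n) a01 ,
  λ b01 → ¬b01 (Equivalence.to (Cyclic01At⇔Is01At b i<n) b01)

Separates-σ : ∀ {n} {a b : Vec Bit n} {i} → Separates a b i → Separates (σ a) (σ b) (next n i)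
Separates-σ {a = a} {b} (pos , a01 , ¬b01) =
  next-position pos ,
  Equivalence.from (Cyclic01At-σ a pos) a01 ,
  λ b01 → ¬b01 (Equivalence.to (Cyclic01At-σ b pos) b01)

Separates⇒¬SameM : ∀ {n} {a b : Vec Bit n} {i} → Separates a b i → i < n → ¬ SameM a b
Separates⇒¬SameM {a = a} {b} {suc m} (_ , a01 , ¬b01) i<n =
  Is01At-separates a b m (Equivalence.to (Cyclic01At⇔Is01At a i<n) a01)
                         (λ b01 → ¬b01 (Equivalence.from (Cyclic01At⇔Is01At b i<n) b01))

record CyclicSeparation {n} (a b : Vec Bit n) : Set where
  constructor cyclicSeparation
  field
    {i j}     : ℕ
    i≢j       : i ≢ j
    a-only-at : Separates a b i
    b-only-at : Separates b a j

CyclicSeparation-σ : ∀ {n} {a b : Vec Bit n} → CyclicSeparation a b → CyclicSeparation (σ a) (σ b)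
CyclicSeparation-σ sep = record
  { i≢j       = λ eq → i≢j (next-injective (proj₁ a-only-at) (proj₁ b-only-at) eq)
  ; a-only-at = Separates-σ a-only-at
  ; b-only-at = Separates-σ b-only-at
  }
  where open CyclicSeparation sep

CyclicSeparation-σ^ : ∀ {n} {a b : Vec Bit n} → CyclicSeparation a b →
                      ∀ k → CyclicSeparation (σ^ k a) (σ^ k b)
CyclicSeparation-σ^ sep zero    = sep
CyclicSeparation-σ^ sep (suc k) = CyclicSeparation-σ (CyclicSeparation-σ^ sep k)

-- Since i ≢ j, at most one of the two separating positions is n.
CyclicSeparation⇒¬SameM : ∀ {n} {a b : Vec Bit n} → CyclicSeparation a b → ¬ SameM a b
CyclicSeparation⇒¬SameM {a = a} {b}
  (cyclicSeparation i≢j sepᵢ@((_ , i≤n) , _) sepⱼ@((_ , j≤n) , _)) same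
  with m≤n⇒m<n∨m≡n i≤n | m≤n⇒m<n∨m≡n j≤n
... | inj₁ i<n  | _         = Separates⇒¬SameM {a = a} {b} sepᵢ i<n same
... | inj₂ _    | inj₁ j<n  = Separates⇒¬SameM {a = b} {a} sepⱼ j<n (SameM-sym a b same)
... | inj₂ refl | inj₂ refl = i≢j refl

lemma20 : ∀ {n} (x y : Vec Bit n) (i j : ℕ) →
    1 ≤ i → i < n → 1 ≤ j → j < n → i ≢ j →
    Is01At x i → ¬ Is01At y i →
    ¬ Is01At x j → Is01At y j →
    ∀ (k : ℕ) → ¬ SameM (σ^ k x) (σ^ k y)
lemma20 x y i j 1≤i i<n 1≤j j<n i≢j xi ¬yi ¬xj yj k =
  CyclicSeparation⇒¬SameM (CyclicSeparation-σ^ initial k)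
  where
    initial : CyclicSeparation x y
    initial = cyclicSeparation i≢j (Is01At⇒Separates x y 1≤i i<n xi ¬yi)
                                   (Is01At⇒Separates y x 1≤j j<n yj ¬xj)
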